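{- For every integer $n \ge 1$, there exists an NFA with $n$ states and an alphabet of $n$ letters that admits a mortal word and whose shortest mortal word has length exactly $2^n - 1$.
   Context: An NFA (nondeterministic finite semi-automaton, with no initial or final states) is a triple $(Q, \Sigma, \Delta)$ where $Q$ is a finite set of states, $\Sigma$ is a finite alphabet, and $\Delta: Q \times \Sigma \to 2^Q$ is a transition relation; possibly $\Delta(q,a) = \emptyset$. Write $q \cdot a = \Delta(q,a)$, extend to words by $q \cdot \varepsilon = \{q\}$ and $q \cdot (wa) = \bigcup_{p \in q \cdot w} p \cdot a$, and to sets $S \subseteq Q$ by $S \cdot w = \bigcup_{q \in S} q \cdot w$. A word $w \in \Sigma^*$ is mortal for the NFA if $Q \cdot w = \emptyset$. The NFA's states are counted by $|Q|$ and its letters by $|\Sigma|$. -}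

module Defs where

open import Data.Nat using (ℕ)
open import Data.Fin using (Fin)
open import Data.Fin.Subset using (Subset; ⊥; ⊤; ⋃; _∈_)
open import Data.List using (List; []; _∷_)
open import Relation.Binary.PropositionalEquality using (_≡_)

record NFA (q s : ℕ) : Set where
  field
    Δ : Fin q → Fin s → Subset q

open NFA public

Word : ℕ → Set
Word s = List (Fin s)

open import Data.Bool using (if_then_else_)
open import Data.Vec using (lookup)
open import Data.List using (allFin) renaming (map to lmap)

stepSet : ∀ {q s} → NFA q s → Subset q → Fin s → Subset q
stepSet {q} A S a = ⋃ (lmap (λ p → if lookup S p then Δ A p a else ⊥) (allFin q))

stepWord : ∀ {q s} → NFA q s → Subset q → Word s → Subset q
stepWord A S []      = S
stepWord A S (a ∷ w) = stepWord A (stepSet A S a) w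

Mortal : ∀ {q s} → NFA q s → Word s → Set
Mortal A w = stepWord A ⊤ w ≡ ⊥

-- Read a set S ⊆ {0,…,n−1} as the binary number Σ_{b ∈ S} 2^b, so that Q has value 2^n − 1
-- and ∅ has value 0. Letter a acts on a state p by p·a = {p} if p > a, {p, a} if p < a and
-- {0,…,a−1} if p = a, so on sets it is a binary-counter move: bits above a are unchanged, bits
-- below a can only be set, and bit a is cleared only when no bit below it was set, in which case
-- all of them become set. Thus no letter lowers the value by more than 1, and the least element
-- of a nonempty S lowers it by exactly 1; so ∅ is reached from Q in exactly 2^n − 1 letters.
module Submission where

open import Defs
open import Data.Nat using (ℕ; _≥_; _≤_; _∸_; _^_)
open import Data.Product using (Σ; _×_)
open import Data.List using (length)
open import Relation.Binary.PropositionalEquality using (_≡_)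

open import Function using (_∘_)
open import Data.Nat using (zero; suc; _+_; z≤n; s≤s)
open import Data.Nat.Properties using (≤-refl; ≤-trans; ≤-reflexive; +-suc; +-identityʳ; +-mono-≤; m≤n+m; n≤1+n; suc-injective)
open import Data.Bool using (Bool; true; false; _∨_; if_then_else_)
open import Data.Bool.Properties using (if-float; ∨-commutativeMonoid)
open import Algebra.Bundles using (CommutativeMonoid)
open import Algebra.Properties.CommutativeSemigroup (CommutativeMonoid.commutativeSemigroup ∨-commutativeMonoid)
  using () renaming (interchange to ∨-interchange)
open import Data.Fin using (Fin; zero; suc)
open import Data.Fin.Subset using (Subset; ⊥; ⊤; ⋃; _∪_; ⁅_⁆)
open import Data.Fin.Subset.Properties using (∪-identityˡ)
open import Data.Vec using (_∷_; []; lookup)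
open import Data.Vec.Properties using (lookup-zipWith; lookup-replicate)
open import Data.List using ([]; _∷_; allFin; tabulate) renaming (map to lmap)
open import Data.List.Properties using (map-tabulate; tabulate-cong)
open import Data.Product using (_,_; ∃-syntax)
open import Data.Sum using (_⊎_; inj₁; inj₂)
open import Relation.Binary.PropositionalEquality using (refl; sym; trans; cong; cong₂; subst; module ≡-Reasoning)

⋃-tabulate-hom : ∀ {m n k} (f : Subset m → Subset n) → f ⊥ ≡ ⊥ → (∀ S T → f (S ∪ T) ≡ f S ∪ f T) →
                 (g : Fin k → Subset m) → ⋃ (tabulate (f ∘ g)) ≡ f (⋃ (tabulate g))
⋃-tabulate-hom {k = zero}  f f-⊥ f-∪ g = sym f-⊥
⋃-tabulate-hom {k = suc k} f f-⊥ f-∪ g =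
  trans (cong (f (g zero) ∪_) (⋃-tabulate-hom f f-⊥ f-∪ (g ∘ suc))) (sym (f-∪ _ _))

⋃-singletons : ∀ {n} (S : Subset n) → ⋃ (tabulate (λ p → if lookup S p then ⁅ p ⁆ else ⊥)) ≡ S
⋃-singletons-suc : ∀ {n} (S : Subset n) → ⋃ (tabulate (λ p → if lookup S p then ⁅ suc p ⁆ else ⊥)) ≡ false ∷ S

⋃-singletons []          = refl
⋃-singletons (false ∷ S) = trans (∪-identityˡ _) (⋃-singletons-suc S)
⋃-singletons (true ∷ S)  = trans (cong ((true ∷ ⊥) ∪_) (⋃-singletons-suc S)) (cong (true ∷_) (∪-identityˡ S))

⋃-singletons-suc S = begin
  ⋃ (tabulate (λ p → if lookup S p then ⁅ suc p ⁆ else ⊥))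
    ≡⟨ cong ⋃ (tabulate-cong (λ p → sym (if-float (false ∷_) (lookup S p)))) ⟩
  ⋃ (tabulate (λ p → false ∷ (if lookup S p then ⁅ p ⁆ else ⊥)))
    ≡⟨ ⋃-tabulate-hom (false ∷_) refl (λ _ _ → refl) (λ p → if lookup S p then ⁅ p ⁆ else ⊥) ⟩
  false ∷ ⋃ (tabulate (λ p → if lookup S p then ⁅ p ⁆ else ⊥))
    ≡⟨ cong (false ∷_) (⋃-singletons S) ⟩
  false ∷ S ∎
  where open ≡-Reasoning

stepSet-hom : ∀ {n s} (A : NFA n s) (f : Fin s → Subset n → Subset n) →
              (∀ a → f a ⊥ ≡ ⊥) → (∀ a S T → f a (S ∪ T) ≡ f a S ∪ f a T) →
              (∀ p a → Δ A p a ≡ f a ⁅ p ⁆) → ∀ S a → stepSet A S a ≡ f a S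
stepSet-hom {n} A f f-⊥ f-∪ Δ≡f S a = begin
  ⋃ (lmap (λ p → if lookup S p then Δ A p a else ⊥) (allFin n))
    ≡⟨ cong ⋃ (map-tabulate (λ p → p) (λ p → if lookup S p then Δ A p a else ⊥)) ⟩
  ⋃ (tabulate (λ p → if lookup S p then Δ A p a else ⊥))
    ≡⟨ cong ⋃ (tabulate-cong (λ p → if-image (lookup S p) p)) ⟩
  ⋃ (tabulate (λ p → f a (if lookup S p then ⁅ p ⁆ else ⊥)))
    ≡⟨ ⋃-tabulate-hom (f a) (f-⊥ a) (f-∪ a) (λ p → if lookup S p then ⁅ p ⁆ else ⊥) ⟩
  f a (⋃ (tabulate (λ p → if lookup S p then ⁅ p ⁆ else ⊥)))
    ≡⟨ cong (f a) (⋃-singletons S) ⟩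
  f a S ∎
  where
  open ≡-Reasoning
  if-image : ∀ b p → (if b then Δ A p a else ⊥) ≡ f a (if b then ⁅ p ⁆ else ⊥)
  if-image true  p = Δ≡f p a
  if-image false p = sym (f-⊥ a)

-- tickᶜ c is tick on the bits from the current position up, where c records whether a bit
-- below the current position is set.
tickᶜ : ∀ {n} → Bool → Fin n → Subset n → Subset n
tickᶜ c zero    (b ∷ S) = c ∷ S
tickᶜ c (suc a) (b ∷ S) = (b ∨ lookup S a) ∷ tickᶜ (b ∨ c) a S

tick : ∀ {n} → Fin n → Subset n → Subset n
tick = tickᶜ false

counter : ∀ n → NFA n n
counter n = record { Δ = λ p a → tick a ⁅ p ⁆ }

tickᶜ-∪ : ∀ {n} c d (a : Fin n) S T → tickᶜ (c ∨ d) a (S ∪ T) ≡ tickᶜ c a S ∪ tickᶜ d a T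
tickᶜ-∪ c d zero    (x ∷ S) (y ∷ T) = refl
tickᶜ-∪ c d (suc a) (x ∷ S) (y ∷ T) = cong₂ _∷_
  (trans (cong ((x ∨ y) ∨_) (lookup-zipWith _∨_ a S T)) (∨-interchange x y (lookup S a) (lookup T a)))
  (trans (cong (λ e → tickᶜ e a (S ∪ T)) (∨-interchange x y c d)) (tickᶜ-∪ (x ∨ c) (y ∨ d) a S T))

tick-⊥ : ∀ {n} (a : Fin n) → tick a ⊥ ≡ ⊥
tick-⊥ zero    = refl
tick-⊥ (suc a) = cong₂ _∷_ (lookup-replicate a false) (tick-⊥ a)

stepSet-counter : ∀ {n} (S : Subset n) a → stepSet (counter n) S a ≡ tick a S
stepSet-counter {n} = stepSet-hom (counter n) tick tick-⊥ (tickᶜ-∪ false false) (λ _ _ → refl)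

bit : Bool → ℕ
bit false = 0
bit true  = 1

-- Position zero is the least significant bit.
value : ∀ {n} → Subset n → ℕ
value []      = 0
value (b ∷ S) = bit b + (value S + value S)

value-⊥ : ∀ n → value (⊥ {n}) ≡ 0
value-⊥ zero    = refl
value-⊥ (suc n) = cong (λ v → v + v) (value-⊥ n)

suc-value-⊤ : ∀ n → suc (value (⊤ {n})) ≡ 2 ^ n
suc-value-⊤ zero    = refl
suc-value-⊤ (suc n) = begin
  suc (suc (value (⊤ {n}) + value (⊤ {n})))  ≡⟨ cong suc (+-suc (value (⊤ {n})) (value (⊤ {n}))) ⟨
  suc (value (⊤ {n})) + suc (value (⊤ {n}))  ≡⟨ cong₂ _+_ (suc-value-⊤ n) (suc-value-⊤ n) ⟩
  2 ^ n + 2 ^ n                                ≡⟨ cong (2 ^ n +_) (+-identityʳ (2 ^ n)) ⟨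
  2 ^ suc n                                    ∎
  where open ≡-Reasoning

double-mono-≤ : ∀ {x y} → x ≤ y → x + x ≤ y + y
double-mono-≤ x≤y = +-mono-≤ x≤y x≤y

bit≤1 : ∀ b → bit b ≤ 1
bit≤1 false = z≤n
bit≤1 true  = ≤-refl

value≤value-tickᶜ-true : ∀ {n} (a : Fin n) S → value S ≤ value (tickᶜ true a S)
value≤value-tickᶜ-true zero    (b ∷ S)     = +-mono-≤ (bit≤1 b) ≤-refl
value≤value-tickᶜ-true (suc a) (false ∷ S) =
  ≤-trans (double-mono-≤ (value≤value-tickᶜ-true a S)) (m≤n+m _ (bit (lookup S a)))
value≤value-tickᶜ-true (suc a) (true ∷ S)  = s≤s (double-mono-≤ (value≤value-tickᶜ-true a S))

value≤value-tickᶜ-∉ : ∀ {n} c (a : Fin n) S → lookup S a ≡ false → value S ≤ value (tickᶜ c a S)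
value≤value-tickᶜ-∉ c zero    (false ∷ S) refl = m≤n+m _ (bit c)
value≤value-tickᶜ-∉ c (suc a) (true ∷ S)  a∉S  = s≤s (double-mono-≤ (value≤value-tickᶜ-∉ true a S a∉S))
value≤value-tickᶜ-∉ c (suc a) (false ∷ S) a∉S rewrite a∉S = double-mono-≤ (value≤value-tickᶜ-∉ c a S a∉S)

value≤suc-value-tickᶜ : ∀ {n} c (a : Fin n) S → value S ≤ suc (value (tickᶜ c a S))
value≤suc-value-tickᶜ c zero    (b ∷ S)     = +-mono-≤ (bit≤1 b) (m≤n+m _ (bit c))
value≤suc-value-tickᶜ c (suc a) (true ∷ S)  = ≤-trans (s≤s (double-mono-≤ (value≤value-tickᶜ-true a S))) (n≤1+n _)
value≤suc-value-tickᶜ c (suc a) (false ∷ S) with lookup S a in S[a]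
... | false = ≤-trans (double-mono-≤ (value≤value-tickᶜ-∉ c a S S[a])) (n≤1+n _)
... | true  = ≤-trans (double-mono-≤ (value≤suc-value-tickᶜ c a S))
                      (≤-reflexive (cong suc (+-suc (value (tickᶜ c a S)) _)))

⊥⊎tick-decrements : ∀ {n} (S : Subset n) → S ≡ ⊥ ⊎ ∃[ a ] (lookup S a ≡ true × suc (value (tick a S)) ≡ value S)
⊥⊎tick-decrements []         = inj₁ refl
⊥⊎tick-decrements (true ∷ S) = inj₂ (zero , refl , refl)
⊥⊎tick-decrements (false ∷ S) with ⊥⊎tick-decrements S
... | inj₁ S≡⊥ = inj₁ (cong (false ∷_) S≡⊥)
... | inj₂ (a , a∈S , dec) = inj₂ (suc a , a∈S , decrement)
  where
  open ≡-Reasoning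
  decrement : suc (value (tick (suc a) (false ∷ S))) ≡ value (false ∷ S)
  decrement = begin
    suc (bit (lookup S a) + (t + t))  ≡⟨ cong (λ b → suc (bit b + (t + t))) a∈S ⟩
    suc (suc (t + t))                 ≡⟨ cong suc (+-suc t t) ⟨
    suc t + suc t                     ≡⟨ cong₂ _+_ dec dec ⟩
    value S + value S                 ∎
    where t = value (tick a S)

value≤length+value-stepWord : ∀ {n} (S : Subset n) w → value S ≤ length w + value (stepWord (counter n) S w)
value≤length+value-stepWord     S []      = ≤-refl
value≤length+value-stepWord {n} S (a ∷ w) = ≤-trans (value≤suc-value-tickᶜ false a S) (s≤s
  (subst (λ T → value T ≤ length w + value (stepWord (counter n) S (a ∷ w))) (stepSet-counter S a)
         (value≤length+value-stepWord (stepSet (counter n) S a) w)))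

value≤length-killing : ∀ {n} (S : Subset n) w → stepWord (counter n) S w ≡ ⊥ → value S ≤ length w
value≤length-killing {n} S w S·w≡⊥ = ≤-trans (value≤length+value-stepWord S w) (≤-reflexive (begin
  length w + value (stepWord (counter n) S w)  ≡⟨ cong (λ T → length w + value T) S·w≡⊥ ⟩
  length w + value (⊥ {n})                     ≡⟨ cong (length w +_) (value-⊥ n) ⟩
  length w + 0                                 ≡⟨ +-identityʳ (length w) ⟩
  length w                                     ∎))
  where open ≡-Reasoning

killing-word : ∀ {n} k (S : Subset n) → value S ≡ k → ∃[ w ] (stepWord (counter n) S w ≡ ⊥ × length w ≡ k)
killing-word {n} k S value-S≡k with ⊥⊎tick-decrements S
... | inj₁ S≡⊥ = [] , S≡⊥ , trans (sym (value-⊥ n)) (trans (cong value (sym S≡⊥)) value-S≡k)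
killing-word zero    S value-S≡0 | inj₂ (a , _ , dec) with () ← trans dec value-S≡0
killing-word {n} (suc k) S value-S≡1+k | inj₂ (a , _ , dec)
  with w , tick-a-S·w≡⊥ , length-w≡k ← killing-word k (tick a S) (suc-injective (trans dec value-S≡1+k))
  = a ∷ w , subst (λ T → stepWord (counter n) T w ≡ ⊥) (sym (stepSet-counter S a)) tick-a-S·w≡⊥ , cong suc length-w≡k

theorem4 : (n : ℕ) → n ≥ 1 →
    Σ (NFA n n) λ A →
      Σ (Word n) (λ w → Mortal A w × length w ≡ 2 ^ n ∸ 1)
      × ((w : Word n) → Mortal A w → 2 ^ n ∸ 1 ≤ length w)
theorem4 n _ with w , Q·w≡⊥ , length-w≡value-⊤ ← killing-word (value (⊤ {n})) ⊤ refl
  = counter n , (w , Q·w≡⊥ , trans length-w≡value-⊤ value-⊤) , shortest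
  where
  value-⊤ : value (⊤ {n}) ≡ 2 ^ n ∸ 1
  value-⊤ = cong (_∸ 1) (suc-value-⊤ n)
  shortest : (w : Word n) → Mortal (counter n) w → 2 ^ n ∸ 1 ≤ length w
  shortest w mortal = subst (_≤ length w) value-⊤ (value≤length-killing ⊤ w mortal)
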